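{- Let $D=(V,A)$ be a finite directed acyclic graph (DAG). The following four statements are equivalent: (1) $D$ is a funnel. (2) For every vertex $v\in V$ with in-degree $\deg^-(v)>1$, every vertex $u$ reachable from $v$ by a directed path (including $u=v$) satisfies $\deg^+(u)\le 1$. (3) $D$ has no subgraph isomorphic to any digraph $D_k$, $k\in\{0,1,2,\dots\}$, where $D_k=(V_k,A_k)$ with $V_k=\{u_1,u_2,v_0,w_1,w_2\}\cup\{v_1,\dots,v_k\}$ (all distinct) and $A_k=\{(u_1,v_0),(u_2,v_0),(v_k,w_1),(v_k,w_2)\}\cup\{(v_i,v_{i+1}) : 0\le i\le k-1\}$. (4) Neither $D_0$ nor $D_1$ (as defined in (3)) is a topological minor of $D$.
   Context: A source is a vertex of in-degree $0$ and a sink is a vertex of out-degree $0$; $\deg^-(v)$ and $\deg^+(v)$ denote in- and out-degree. A source-sink path is a directed path from a source to a sink. An arc is private if exactly one source-sink path contains it. A DAG is a funnel if every source-sink path has at least one private arc. A digraph $H$ is a topological minor of $G$ if some subgraph of $G$ can be obtained from $H$ by subdividing arcs, i.e. replacing arcs by directed paths. In $D_0$ the vertex $v_k$ is $v_0$, so $A_0=\{(u_1,v_0),(u_2,v_0),(v_0,w_1),(v_0,w_2)\}$. -}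

module Defs where

open import Data.Nat using (ℕ; zero; suc; _+_; _≤_; _<_)
open import Data.Fin using (Fin; fromℕ; inject₁)
open import Data.Bool using (Bool; T; if_then_else_)
open import Data.List using (List; []; _∷_; _++_; [_]; map; allFin)
open import Data.Nat.ListAction using (sum)
open import Data.List.Relation.Unary.Linked using (Linked)
open import Data.List.Relation.Unary.Unique.Propositional using (Unique)
open import Data.List.Membership.Propositional using (_∈_)
open import Data.Product using (Σ; ∃; ∃₂; _×_; _,_)
open import Data.Empty using (⊥)
open import Relation.Nullary using (¬_)
open import Relation.Binary.PropositionalEquality using (_≡_; _≢_)
open import Relation.Binary.Construct.Closure.Transitive using (TransClosure)
open import Relation.Binary.Construct.Closure.ReflexiveTransitive using (Star)
open import Function.Definitions using (Injective)

Digraph : ℕ → Set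
Digraph n = Fin n → Fin n → Bool

module _ {n : ℕ} (G : Digraph n) where

  Arc : Fin n → Fin n → Set
  Arc a b = T (G a b)

  indeg : Fin n → ℕ
  indeg v = sum (map (λ u → if G u v then 1 else 0) (allFin n))

  outdeg : Fin n → ℕ
  outdeg v = sum (map (λ w → if G v w then 1 else 0) (allFin n))

  IsSource : Fin n → Set
  IsSource v = indeg v ≡ 0

  IsSink : Fin n → Set
  IsSink v = outdeg v ≡ 0

  Acyclic : Set
  Acyclic = ∀ v → ¬ TransClosure Arc v v

  IsPath : List (Fin n) → Set
  IsPath P = Linked Arc P × Unique P

  -- a source-sink path (from a source to a sink, with at least one arc)
  SSPath : List (Fin n) → Set
  SSPath P = IsPath P × Σ (Fin n) λ s → Σ (Fin n) λ t → Σ (List (Fin n)) λ mid →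
               (P ≡ s ∷ mid ++ [ t ]) × IsSource s × IsSink t

  ContainsArc : List (Fin n) → Fin n → Fin n → Set
  ContainsArc P a b = ∃₂ λ xs ys → P ≡ xs ++ a ∷ b ∷ ys

  Private : Fin n → Fin n → Set
  Private a b = Arc a b × Σ (List (Fin n)) λ P → SSPath P × ContainsArc P a b ×
                  (∀ Q → SSPath Q → ContainsArc Q a b → Q ≡ P)

  Funnel : Set
  Funnel = ∀ P → SSPath P → ∃₂ λ a b → ContainsArc P a b × Private a b

  Cond2 : Set
  Cond2 = ∀ v → 1 < indeg v → ∀ u → Star Arc v u → outdeg u ≤ 1

data Vk (k : ℕ) : Set where
  u₁ u₂ w₁ w₂ : Vk k
  v : Fin (suc k) → Vk k

data ArcK (k : ℕ) : Vk k → Vk k → Set where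
  a-u₁ : ArcK k u₁ (v Fin.zero)
  a-u₂ : ArcK k u₂ (v Fin.zero)
  a-w₁ : ArcK k (v (fromℕ k)) w₁
  a-w₂ : ArcK k (v (fromℕ k)) w₂
  a-v  : (i : Fin k) → ArcK k (v (inject₁ i)) (v (Fin.suc i))

module _ {n : ℕ} (G : Digraph n) where

  HasSubgraphDk : ℕ → Set
  HasSubgraphDk k = Σ (Vk k → Fin n) λ f → Injective _≡_ _≡_ f ×
                      (∀ {x y} → ArcK k x y → Arc G (f x) (f y))

  -- D_k is a topological minor of G: an injective vertex map together with,
  -- for every arc (x , y) of D_k, a directed path of G from f x to f y
  -- (given by its list of internal vertices), internal vertices avoiding the
  -- image of f, and internal vertices of paths for distinct arcs disjoint.
  record TopMinorDk (k : ℕ) : Set where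
    field
      f        : Vk k → Fin n
      f-inj    : Injective _≡_ _≡_ f
      inner    : ∀ {x y} → ArcK k x y → List (Fin n)
      isPath   : ∀ {x y} (e : ArcK k x y) → IsPath G (f x ∷ inner e ++ [ f y ])
      avoid    : ∀ {x y} (e : ArcK k x y) z → z ∈ inner e → ∀ w → f w ≢ z
      disjoint : ∀ {x y x' y'} (e : ArcK k x y) (e' : ArcK k x' y') →
                   (x , y) ≢ (x' , y') → ∀ z → z ∈ inner e → z ∈ inner e' → ⊥

  Cond3 : Set
  Cond3 = ∀ k → ¬ HasSubgraphDk k

  Cond4 : Set
  Cond4 = ¬ TopMinorDk 0 × ¬ TopMinorDk 1

-- Everything hinges on condition (2). Call a vertex q with two in-arcs that reaches a vertex u
-- with two out-arcs a merge-split. Since every vertex of a DAG lies between a source and a sink,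
-- a merge-split yields three source-sink paths P₁₁, P₁₂, P₂₁ that differ only before q or only
-- after u; a private arc of P₁₁ lies before or after q and is then shared with P₁₂ or P₂₁, so a
-- funnel has no merge-split. Conversely, without merge-splits every source-sink path has an arc
-- (a, b) such that all vertices up to a have in-degree ≤ 1 and all vertices from b on have
-- out-degree ≤ 1 (b is the first vertex of in-degree ≥ 2, or the sink); a source-sink path
-- through (a, b) is then forced both backwards and forwards, so (a, b) is private.
-- A merge-split along a q-u path of length k is a copy of D_k, and a topological minor D_k
-- (in particular a subgraph D_k) contains a merge-split; a subgraph D_(k+1) contracts to a
-- topological minor D_1.

module Submission where

open import Defs
open import Data.Bool using (Bool; true; false; T; if_then_else_)
open import Data.Empty using (⊥)
open import Data.Fin using (Fin; fromℕ; inject₁) renaming (zero to fzero; suc to fsuc)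
import Data.Fin.Properties as Fin
open import Data.List using (List; []; _∷_; _++_; [_]; _∷ʳ_; map; allFin; reverse; reverseAcc)
open import Data.List.Membership.Propositional using (_∈_)
open import Data.List.Membership.Propositional.Properties using (∈-allFin; ∈-++⁺ˡ; ∈-++⁺ʳ)
open import Data.List.Properties
  using (++-assoc; ∷-injectiveˡ; ∷-injectiveʳ; ++-cancelˡ; ++-cancelʳ; ∷ʳ-injectiveʳ; ∷ʳ-++;
         unfold-reverse; reverse-++; reverse-injective)
open import Data.List.Relation.Unary.All as All using (All; []; _∷_)
open import Data.List.Relation.Unary.AllPairs as AllPairs using (AllPairs; []; _∷_)
open import Data.List.Relation.Unary.Any using (here; there)
import Data.List.Relation.Unary.Any.Properties as Any
open import Data.List.Relation.Unary.Linked as Linked using (Linked; []; [-]; _∷_)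
open import Data.List.Relation.Unary.Linked.Properties using (Linked⇒AllPairs)
open import Data.List.Relation.Unary.Unique.Propositional using (Unique)
open import Data.List.Relation.Unary.Unique.Propositional.Properties using (allFin⁺)
open import Data.Nat using (ℕ; zero; suc; _+_; _≤_; _<_; z≤n; s≤s; s≤s⁻¹; _≟_; _≤?_)
open import Data.Nat.ListAction using (sum)
open import Data.Nat.Properties
  using (≤-reflexive; ≤-trans; <-≤-trans; m≤n+m; <⇒≱; ≮⇒≥; ≰⇒>; n≢0⇒n>0; +-suc; +-identityʳ)
open import Data.Product using (∃; ∃₂; _×_; _,_; proj₁; proj₂)
open import Data.Sum using (_⊎_; inj₁; inj₂)
open import Function using (id; flip; _∘_; case_of_)
open import Function.Bundles using (_⇔_; mk⇔)
open import Function.Definitions using (Injective)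
open import Relation.Binary.Construct.Closure.ReflexiveTransitive as Star using (Star; ε; _◅_; _◅◅_)
open import Relation.Binary.Construct.Closure.Transitive as TC
  using (TransClosure) renaming ([_] to [_]⁺; _∷_ to _∷⁺_)
open import Relation.Binary.PropositionalEquality
  using (_≡_; _≢_; refl; sym; trans; cong; cong₂; subst; module ≡-Reasoning)
open import Relation.Nullary using (¬_; yes; no; contradiction)

module _ {A : Set} (p : A → Bool) where

  count : List A → ℕ
  count xs = sum (map (λ x → if p x then 1 else 0) xs)

  ∈⇒0<count : ∀ {x xs} → x ∈ xs → T (p x) → 0 < count xs
  ∈⇒0<count {xs = y ∷ ys} (here refl) px with p y
  ... | true = s≤s z≤n
  ∈⇒0<count {xs = y ∷ ys} (there x∈ys) px =
    <-≤-trans (∈⇒0<count x∈ys px) (m≤n+m _ _)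

  ∈₂⇒1<count : ∀ {x x′ xs} → x ∈ xs → x′ ∈ xs → x ≢ x′ → T (p x) → T (p x′) → 1 < count xs
  ∈₂⇒1<count (here refl) (here refl) x≢x′ _ _ = contradiction refl x≢x′
  ∈₂⇒1<count {xs = y ∷ ys} (here refl) (there x′∈ys) _ px px′ with p y
  ... | true = s≤s (∈⇒0<count x′∈ys px′)
  ∈₂⇒1<count {xs = y ∷ ys} (there x∈ys) (here refl) _ px px′ with p y
  ... | true = s≤s (∈⇒0<count x∈ys px)
  ∈₂⇒1<count (there x∈ys) (there x′∈ys) x≢x′ px px′ =
    <-≤-trans (∈₂⇒1<count x∈ys x′∈ys x≢x′ px px′) (m≤n+m _ _)

  0<count⇒∈ : ∀ {xs} → 0 < count xs → ∃ λ x → x ∈ xs × T (p x)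
  0<count⇒∈ {y ∷ ys} pos with p y in py
  ... | true = y , here refl , subst T (sym py) _
  ... | false with x , x∈ys , px ← 0<count⇒∈ pos = x , there x∈ys , px

  1<count⇒∈₂ : ∀ {xs} → Unique xs → 1 < count xs → ∃₂ λ x x′ → x ≢ x′ × T (p x) × T (p x′)
  1<count⇒∈₂ {y ∷ ys} (y∉ys ∷ uniq) many with p y in py
  ... | true with x , x∈ys , px ← 0<count⇒∈ (s≤s⁻¹ many) =
    y , x , All.lookup y∉ys x∈ys , subst T (sym py) _ , px
  ... | false = 1<count⇒∈₂ uniq many

-- Arc (G ᵒᵖ) x y, indeg (G ᵒᵖ) and IsSource (G ᵒᵖ) unfold to Arc G y x, outdeg G and IsSink G,
-- so every statement about in-degrees yields its out-degree dual.
_ᵒᵖ : ∀ {n} → Digraph n → Digraph n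
(G ᵒᵖ) x y = G y x

module Degrees {n : ℕ} (G : Digraph n) where

  source-has-no-in : ∀ {x y} → IsSource G y → ¬ Arc G x y
  source-has-no-in {x} {y} y-src e =
    <⇒≱ (∈⇒0<count (λ x → G x y) (∈-allFin x) e) (≤-reflexive y-src)

  indeg≤1⇒in-unique : ∀ {x x′ y} → indeg G y ≤ 1 → Arc G x y → Arc G x′ y → x ≡ x′
  indeg≤1⇒in-unique {x} {x′} {y} in≤1 e e′ with x Fin.≟ x′
  ... | yes x≡x′ = x≡x′
  ... | no x≢x′ =
    contradiction in≤1 (<⇒≱ (∈₂⇒1<count (λ x → G x y) (∈-allFin x) (∈-allFin x′) x≢x′ e e′))

  1<indeg⇒in₂ : ∀ {y} → 1 < indeg G y → ∃₂ λ x x′ → x ≢ x′ × Arc G x y × Arc G x′ y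
  1<indeg⇒in₂ {y} = 1<count⇒∈₂ (λ x → G x y) {allFin n} (allFin⁺ n)

  in₂⇒1<indeg : ∀ {x x′ y} → x ≢ x′ → Arc G x y → Arc G x′ y → 1 < indeg G y
  in₂⇒1<indeg {x} {x′} {y} = ∈₂⇒1<count (λ x → G x y) (∈-allFin x) (∈-allFin x′)

  non-source⇒in : ∀ y → ¬ IsSource G y → ∃ λ x → Arc G x y
  non-source⇒in y ¬src with x , _ , e ← 0<count⇒∈ (λ x → G x y) {allFin n} (n≢0⇒n>0 ¬src) = x , e

open Degrees public

sink-has-no-out : ∀ {n} (G : Digraph n) {x y} → IsSink G x → ¬ Arc G x y
sink-has-no-out G = source-has-no-in (G ᵒᵖ)

outdeg≤1⇒out-unique : ∀ {n} (G : Digraph n) {x y y′} → outdeg G x ≤ 1 → Arc G x y → Arc G x y′ → y ≡ y′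
outdeg≤1⇒out-unique G = indeg≤1⇒in-unique (G ᵒᵖ)

1<outdeg⇒out₂ : ∀ {n} (G : Digraph n) {x} → 1 < outdeg G x → ∃₂ λ y y′ → y ≢ y′ × Arc G x y × Arc G x y′
1<outdeg⇒out₂ G = 1<indeg⇒in₂ (G ᵒᵖ)

out₂⇒1<outdeg : ∀ {n} (G : Digraph n) {x y y′} → y ≢ y′ → Arc G x y → Arc G x y′ → 1 < outdeg G x
out₂⇒1<outdeg G = in₂⇒1<indeg (G ᵒᵖ)

module _ {A : Set} {R : A → A → Set} where

  linked-++⁻ˡ : ∀ xs {ys} → Linked R (xs ++ ys) → Linked R xs
  linked-++⁻ˡ []           _         = []
  linked-++⁻ˡ (x ∷ [])     _         = [-]
  linked-++⁻ˡ (x ∷ y ∷ xs) (r ∷ rs) = r ∷ linked-++⁻ˡ (y ∷ xs) rs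

  linked-++⁻ʳ : ∀ xs {ys} → Linked R (xs ++ ys) → Linked R ys
  linked-++⁻ʳ []           rs       = rs
  linked-++⁻ʳ (x ∷ [])     [-]      = []
  linked-++⁻ʳ (x ∷ [])     (_ ∷ rs) = rs
  linked-++⁻ʳ (x ∷ y ∷ xs) (_ ∷ rs) = linked-++⁻ʳ (y ∷ xs) rs

  linked⇒star : ∀ {x} zs {y} → Linked R (x ∷ zs ∷ʳ y) → Star R x y
  linked⇒star []       (r ∷ _)  = r ◅ ε
  linked⇒star (z ∷ zs) (r ∷ rs) = r ◅ linked⇒star zs rs

  linked⇒star-∈ : ∀ {x xs z} → Linked R (x ∷ xs) → z ∈ x ∷ xs → Star R x z
  linked⇒star-∈ _        (here refl) = ε
  linked⇒star-∈ (r ∷ rs) (there z∈)  = r ◅ linked⇒star-∈ rs z∈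

  linked⇒last-step : ∀ x zs {y} → Linked R (x ∷ zs ∷ʳ y) → ∃ λ c → c ∈ x ∷ zs × R c y
  linked⇒last-step x []       (r ∷ _)  = x , here refl , r
  linked⇒last-step x (z ∷ zs) (_ ∷ rs) with c , c∈ , r ← linked⇒last-step z zs rs = c , there c∈ , r

  linked⇒first-step : ∀ x zs {y} → Linked R (x ∷ zs ∷ʳ y) → ∃ λ c → c ∈ y ∷ zs × R x c
  linked⇒first-step x []       (r ∷ _) = _ , here refl , r
  linked⇒first-step x (z ∷ zs) (r ∷ _) = z , there (here refl) , r

  linked-reverse : ∀ {xs} → Linked R xs → Linked (flip R) (reverse xs)
  linked-reverse []             = []
  linked-reverse {x ∷ xs} rs = go xs rs [-]
    where
    go : ∀ {x} xs {acc} → Linked R (x ∷ xs) → Linked (flip R) (x ∷ acc) →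
         Linked (flip R) (reverseAcc (x ∷ acc) xs)
    go []       _        racc = racc
    go (y ∷ ys) (r ∷ rs) racc = go ys rs (r ∷ racc)

module Walks {n : ℕ} (G : Digraph n) where

  infix 4 _⇝_ _⇝⁺_
  _⇝_ _⇝⁺_ : Fin n → Fin n → Set
  _⇝_  = Star (Arc G)
  _⇝⁺_ = TransClosure (Arc G)

  tail-vertices : ∀ {x y} → x ⇝ y → List (Fin n)
  tail-vertices ε                = []
  tail-vertices (_◅_ {j = y} _ w) = y ∷ tail-vertices w

  vertices : ∀ {x y} → x ⇝ y → List (Fin n)
  vertices {x} w = x ∷ tail-vertices w

  vertices-linked : ∀ {x y} (w : x ⇝ y) → Linked (Arc G) (vertices w)
  vertices-linked ε           = [-]
  vertices-linked (e ◅ ε)     = e ∷ [-]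
  vertices-linked (e ◅ e′ ◅ w) = e ∷ vertices-linked (e′ ◅ w)

  vertices-◅◅ : ∀ {x y z t} (w : x ⇝ y) (e : Arc G y z) (w′ : z ⇝ t) →
                vertices (w ◅◅ e ◅ w′) ≡ vertices w ++ vertices w′
  vertices-◅◅ ε        e w′ = refl
  vertices-◅◅ {x} (e′ ◅ w) e w′ = cong (x ∷_) (vertices-◅◅ w e w′)

  vertices-∷ʳ : ∀ {x y} (w : x ⇝ y) → ∃ λ zs → vertices w ≡ zs ∷ʳ y
  vertices-∷ʳ ε = [] , refl
  vertices-∷ʳ {x} (e ◅ w) with zs , eq ← vertices-∷ʳ w = x ∷ zs , cong (x ∷_) eq

  vertices-last : ∀ {x y x′ y′} (w : x ⇝ y) (w′ : x′ ⇝ y′) → vertices w ≡ vertices w′ → y ≡ y′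
  vertices-last w w′ eq with zs , eq₁ ← vertices-∷ʳ w | zs′ , eq₂ ← vertices-∷ʳ w′ =
    ∷ʳ-injectiveʳ zs zs′ (trans (sym eq₁) (trans eq eq₂))

  vertices-interior : ∀ {x y} → x ≢ y → (w : x ⇝ y) → ∃ λ zs → vertices w ≡ x ∷ zs ∷ʳ y
  vertices-interior x≢y ε       = contradiction refl x≢y
  vertices-interior x≢y (e ◅ w) with zs , eq ← vertices-∷ʳ w = zs , cong (_ ∷_) eq


module DAG {n : ℕ} (G : Digraph n) (acyclic : Acyclic G) where
  open Walks G

  ⇝⁺⇒≢ : ∀ {x y} → x ⇝⁺ y → x ≢ y
  ⇝⁺⇒≢ c refl = acyclic _ c

  ⇝-◅⁺ : ∀ {x y z} → Arc G x y → y ⇝ z → x ⇝⁺ z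
  ⇝-◅⁺ e ε       = [ e ]⁺
  ⇝-◅⁺ e (e′ ◅ w) = e ∷⁺ ⇝-◅⁺ e′ w

  ⇝-◅◅⁺ : ∀ {x y z} → x ⇝ y → y ⇝⁺ z → x ⇝⁺ z
  ⇝-◅◅⁺ ε       c = c
  ⇝-◅◅⁺ (e ◅ w) c = e ∷⁺ ⇝-◅◅⁺ w c

  linked⇒allPairs⁺ : ∀ {xs} → Linked (Arc G) xs → AllPairs _⇝⁺_ xs
  linked⇒allPairs⁺ = Linked⇒AllPairs (TC.transitive (Arc G)) ∘ Linked.map [_]⁺

  linked⇒unique : ∀ {xs} → Linked (Arc G) xs → Unique xs
  linked⇒unique = AllPairs.map ⇝⁺⇒≢ ∘ linked⇒allPairs⁺

  arc-isPath : ∀ {x y} → Arc G x y → IsPath G (x ∷ [] ∷ʳ y)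
  arc-isPath e = e ∷ [-] , linked⇒unique (e ∷ [-])

  linked⇒interior-between : ∀ {x zs y z} → Linked (Arc G) (x ∷ zs ∷ʳ y) → z ∈ zs → x ⇝⁺ z × z ⇝⁺ y
  linked⇒interior-between {zs = zs} {y} rs z∈ with from-x ∷ ps ← linked⇒allPairs⁺ rs =
    All.lookup from-x (∈-++⁺ˡ z∈) , to-last ps z∈
    where
    to-last : ∀ {zs z} → AllPairs _⇝⁺_ (zs ∷ʳ y) → z ∈ zs → z ⇝⁺ y
    to-last {_ ∷ zs} (from-z ∷ _) (here refl) = All.lookup from-z (∈-++⁺ʳ zs (here refl))
    to-last          (_ ∷ ps)     (there z∈)  = to-last ps z∈

  record IndexedPath (a b : Fin n) : Set where
    field
      len              : ℕ
      vertex           : Fin (suc len) → Fin n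
      vertex-first     : vertex fzero ≡ a
      vertex-last      : vertex (fromℕ len) ≡ b
      step             : (i : Fin len) → Arc G (vertex (inject₁ i)) (vertex (fsuc i))
      from-start       : ∀ i → a ⇝ vertex i
      to-end           : ∀ i → vertex i ⇝ b
      vertex-injective : Injective _≡_ _≡_ vertex

  toIndexedPath : ∀ {a b} → a ⇝ b → IndexedPath a b
  toIndexedPath {a} ε = record
    { len = 0 ; vertex = λ _ → a ; vertex-first = refl ; vertex-last = refl ; step = λ ()
    ; from-start = λ _ → ε ; to-end = λ _ → ε ; vertex-injective = λ { {fzero} {fzero} _ → refl } }
  toIndexedPath {a} {b} (e ◅ w) = record
    { len = suc W.len ; vertex = vertex ; vertex-first = refl ; vertex-last = W.vertex-last
    ; step = step ; from-start = from-start ; to-end = to-end ; vertex-injective = injective }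
    where
    module W = IndexedPath (toIndexedPath w)
    vertex : Fin (suc (suc W.len)) → Fin n
    vertex fzero    = a
    vertex (fsuc i) = W.vertex i
    step : ∀ i → Arc G (vertex (inject₁ i)) (vertex (fsuc i))
    step fzero    = subst (Arc G a) (sym W.vertex-first) e
    step (fsuc i) = W.step i
    from-start : ∀ i → a ⇝ vertex i
    from-start fzero    = ε
    from-start (fsuc i) = e ◅ W.from-start i
    to-end : ∀ i → vertex i ⇝ b
    to-end fzero    = e ◅ w
    to-end (fsuc i) = W.to-end i
    injective : Injective _≡_ _≡_ vertex
    injective {fzero}  {fzero}  _  = refl
    injective {fzero}  {fsuc j} eq = contradiction eq (⇝⁺⇒≢ (⇝-◅⁺ e (W.from-start j)))
    injective {fsuc i} {fzero}  eq = contradiction (sym eq) (⇝⁺⇒≢ (⇝-◅⁺ e (W.from-start i)))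
    injective {fsuc i} {fsuc j} eq = cong fsuc (W.vertex-injective eq)

  ⇝-length<n : ∀ {a b} (w : a ⇝ b) → IndexedPath.len (toIndexedPath w) < n
  ⇝-length<n w = Fin.injective⇒≤ (IndexedPath.vertex-injective (toIndexedPath w))

  source-above : ∀ x → ∃ λ s → IsSource G s × s ⇝ x
  source-above x = extend n ε (≤-reflexive (sym (+-identityʳ n)))
    where
    extend : ∀ fuel {y} (w : y ⇝ x) → n ≤ fuel + IndexedPath.len (toIndexedPath w) →
             ∃ λ s → IsSource G s × s ⇝ x
    extend zero       w bound = contradiction bound (<⇒≱ (⇝-length<n w))
    extend (suc fuel) {y} w bound with indeg G y ≟ 0
    ... | yes y-src = y , y-src , w
    ... | no ¬y-src with z , e ← non-source⇒in G y ¬y-src =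
      extend fuel (e ◅ w) (subst (n ≤_) (sym (+-suc fuel _)) bound)

transpose-acyclic : ∀ {n} {G : Digraph n} → Acyclic G → Acyclic (G ᵒᵖ)
transpose-acyclic {G = G} acyclic x c = acyclic x (reverse⁺ c)
  where
  reverse⁺ : ∀ {x y} → TransClosure (Arc (G ᵒᵖ)) x y → TransClosure (Arc G) y x
  reverse⁺ [ e ]⁺    = [ e ]⁺
  reverse⁺ (e ∷⁺ c) = reverse⁺ c TC.∷ʳ e

sink-below : ∀ {n} (G : Digraph n) → Acyclic G → ∀ x → ∃ λ t → IsSink G t × Star (Arc G) x t
sink-below G acyclic x with t , t-sink , w ← DAG.source-above (G ᵒᵖ) (transpose-acyclic acyclic) x =
  t , t-sink , Star.reverse id w

module PathEnds {n : ℕ} (G : Digraph n) where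

  StartsInSource EndsInSink : List (Fin n) → Set
  StartsInSource []      = ⊥
  StartsInSource (x ∷ _) = IsSource G x
  EndsInSink []           = ⊥
  EndsInSink (x ∷ [])     = IsSink G x
  EndsInSink (_ ∷ y ∷ xs) = EndsInSink (y ∷ xs)

  endsInSink-∷ʳ : ∀ {t} → IsSink G t → ∀ xs → EndsInSink (xs ∷ʳ t)
  endsInSink-∷ʳ t-sink []          = t-sink
  endsInSink-∷ʳ t-sink (_ ∷ [])    = t-sink
  endsInSink-∷ʳ t-sink (_ ∷ y ∷ xs) = endsInSink-∷ʳ t-sink (y ∷ xs)

  endsInSink-++⁻ʳ : ∀ xs {y ys} → EndsInSink (xs ++ y ∷ ys) → EndsInSink (y ∷ ys)
  endsInSink-++⁻ʳ []           ends = ends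
  endsInSink-++⁻ʳ (_ ∷ [])     ends = ends
  endsInSink-++⁻ʳ (_ ∷ x ∷ xs) ends = endsInSink-++⁻ʳ (x ∷ xs) ends

  startsInSource-++⁻ˡ : ∀ xs {y ys} → StartsInSource (xs ++ y ∷ ys) → StartsInSource (xs ∷ʳ y)
  startsInSource-++⁻ˡ []      starts = starts
  startsInSource-++⁻ˡ (_ ∷ _) starts = starts

  sink-path-determined : ∀ x ys ys′ → Linked (Arc G) (x ∷ ys) → Linked (Arc G) (x ∷ ys′) →
                         EndsInSink (x ∷ ys) → EndsInSink (x ∷ ys′) →
                         All (λ z → outdeg G z ≤ 1) (x ∷ ys) → ys ≡ ys′
  sink-path-determined x []       []        _        _          _    _    _ = refl
  sink-path-determined x []       (_ ∷ _)   _        (e′ ∷ _)   ends _    _ =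
    contradiction e′ (sink-has-no-out G ends)
  sink-path-determined x (_ ∷ _)  []        (e ∷ _)  _          _    ends _ =
    contradiction e (sink-has-no-out G ends)
  sink-path-determined x (y ∷ ys) (y′ ∷ ys′) (e ∷ rs) (e′ ∷ rs′) ends ends′ (x≤1 ∷ ≤1s)
    with refl ← outdeg≤1⇒out-unique G x≤1 e e′ =
    cong (y ∷_) (sink-path-determined y ys ys′ rs rs′ ends ends′ ≤1s)

open PathEnds public

startsInSource⇒reverse : ∀ {n} (G : Digraph n) xs → StartsInSource G xs → EndsInSink (G ᵒᵖ) (reverse xs)
startsInSource⇒reverse G (x ∷ xs) x-src =
  subst (EndsInSink (G ᵒᵖ)) (sym (unfold-reverse x xs)) (endsInSink-∷ʳ (G ᵒᵖ) x-src (reverse xs))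

source-path-determined : ∀ {n} (G : Digraph n) xs xs′ {y} →
                         Linked (Arc G) (xs ∷ʳ y) → Linked (Arc G) (xs′ ∷ʳ y) →
                         StartsInSource G (xs ∷ʳ y) → StartsInSource G (xs′ ∷ʳ y) →
                         All (λ z → indeg G z ≤ 1) (xs ∷ʳ y) → xs ≡ xs′
source-path-determined G xs xs′ {y} rs rs′ starts starts′ ≤1s =
  reverse-injective (sink-path-determined (G ᵒᵖ) y (reverse xs) (reverse xs′)
    (reversed-linked xs rs) (reversed-linked xs′ rs′)
    (reversed-ends xs starts) (reversed-ends xs′ starts′)
    (subst (All _) (reverse-∷ʳ xs) (All.tabulate (All.lookup ≤1s ∘ Any.reverse⁻))))
  where
  reverse-∷ʳ : ∀ zs → reverse (zs ∷ʳ y) ≡ y ∷ reverse zs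
  reverse-∷ʳ zs = reverse-++ zs [ y ]
  reversed-linked : ∀ zs → Linked (Arc G) (zs ∷ʳ y) → Linked (Arc (G ᵒᵖ)) (y ∷ reverse zs)
  reversed-linked zs rs = subst (Linked _) (reverse-∷ʳ zs) (linked-reverse rs)
  reversed-ends : ∀ zs → StartsInSource G (zs ∷ʳ y) → EndsInSink (G ᵒᵖ) (y ∷ reverse zs)
  reversed-ends zs starts =
    subst (EndsInSink (G ᵒᵖ)) (reverse-∷ʳ zs) (startsInSource⇒reverse G (zs ∷ʳ y) starts)

record MergeSplit {n : ℕ} (G : Digraph n) : Set where
  constructor mergeSplit
  field
    {merge split} : Fin n
    1<indeg-merge  : 1 < indeg G merge
    merge⇝split    : Star (Arc G) merge split
    1<outdeg-split : 1 < outdeg G split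

module _ {n : ℕ} {G : Digraph n} where

  cond2⇒¬mergeSplit : Cond2 G → ¬ MergeSplit G
  cond2⇒¬mergeSplit c2 ms = <⇒≱ 1<outdeg-split (c2 _ 1<indeg-merge _ merge⇝split)
    where open MergeSplit ms

  ¬mergeSplit⇒cond2 : ¬ MergeSplit G → Cond2 G
  ¬mergeSplit⇒cond2 ¬ms q 1<in u q⇝u = ≮⇒≥ (λ 1<out → ¬ms (record
    { 1<indeg-merge = 1<in ; merge⇝split = q⇝u ; 1<outdeg-split = 1<out }))

module SourceSinkPaths {n : ℕ} (G : Digraph n) where

  contains-++ʳ : ∀ {P a b} → ContainsArc G P a b → ∀ L → ContainsArc G (P ++ L) a b
  contains-++ʳ (xs , ys , refl) L = xs , ys ++ L , ++-assoc xs (_ ∷ _ ∷ ys) L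

  contains-++ˡ : ∀ L {P a b} → ContainsArc G P a b → ContainsArc G (L ++ P) a b
  contains-++ˡ L (xs , ys , refl) = L ++ xs , ys , sym (++-assoc L xs (_ ∷ _ ∷ ys))

  contains-split : ∀ X {y L a b} → ContainsArc G (X ++ y ∷ L) a b →
                   ContainsArc G (X ∷ʳ y) a b ⊎ ContainsArc G (y ∷ L) a b
  contains-split []           c                    = inj₂ c
  contains-split (x ∷ [])     ([] , ys , refl)     = inj₁ ([] , [] , refl)
  contains-split (x ∷ x′ ∷ X) {y} ([] , ys , refl) = inj₁ ([] , X ∷ʳ y , refl)
  contains-split (x ∷ X) (_ ∷ xs , ys , eq) with contains-split X (xs , ys , ∷-injectiveʳ eq)
  ... | inj₁ (xs′ , ys′ , eq′) = inj₁ (x ∷ xs′ , ys′ , cong (x ∷_) eq′)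
  ... | inj₂ c                 = inj₂ c

  private-path-unique : ∀ {a b P Q} → Private G a b → SSPath G P → ContainsArc G P a b →
                        SSPath G Q → ContainsArc G Q a b → P ≡ Q
  private-path-unique (_ , _ , _ , _ , unique) ssP cP ssQ cQ =
    trans (unique _ ssP cP) (sym (unique _ ssQ cQ))

  record DegreeCut (P : List (Fin n)) : Set where
    field
      before        : List (Fin n)
      a b           : Fin n
      after         : List (Fin n)
      cut           : P ≡ before ++ a ∷ b ∷ after
      before-indeg  : All (λ x → indeg G x ≤ 1) (before ∷ʳ a)
      after-outdeg  : All (λ x → outdeg G x ≤ 1) (b ∷ after)

  degreeCut : Cond2 G → ∀ x y zs → Linked (Arc G) (x ∷ y ∷ zs) → EndsInSink G (y ∷ zs) →
              indeg G x ≤ 1 → DegreeCut (x ∷ y ∷ zs)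
  degreeCut c2 x y zs (e ∷ rs) ends x≤1 with indeg G y ≤? 1
  ... | no y≰1 = record
    { before = [] ; a = x ; b = y ; after = zs ; cut = refl ; before-indeg = x≤1 ∷ []
    ; after-outdeg = All.tabulate (λ z∈ → c2 y (≰⇒> y≰1) _ (linked⇒star-∈ rs z∈)) }
  degreeCut c2 x y []       (e ∷ rs) ends x≤1 | yes y≤1 = record
    { before = [] ; a = x ; b = y ; after = [] ; cut = refl ; before-indeg = x≤1 ∷ []
    ; after-outdeg = ≤-trans (≤-reflexive ends) z≤n ∷ [] }
  degreeCut c2 x y (z ∷ zs) (e ∷ rs) ends x≤1 | yes y≤1 = record
    { before = x ∷ C.before ; a = C.a ; b = C.b ; after = C.after ; cut = cong (x ∷_) C.cut
    ; before-indeg = x≤1 ∷ C.before-indeg ; after-outdeg = C.after-outdeg }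
    where module C = DegreeCut (degreeCut c2 y z zs rs ends y≤1)

  ssPath-ends : ∀ {P} → SSPath G P → StartsInSource G P × EndsInSink G P
  ssPath-ends (_ , s , t , mid , refl , s-src , t-sink) = s-src , endsInSink-∷ʳ G t-sink (s ∷ mid)

  ssPath-shape : ∀ {P} → SSPath G P → ∃ λ x → ∃₂ λ y zs → P ≡ x ∷ y ∷ zs
  ssPath-shape (_ , s , t , []    , refl , _) = s , t , [] , refl
  ssPath-shape (_ , s , t , y ∷ m , refl , _) = s , y , m ∷ʳ t , refl

  ssPath-halves : ∀ X {a b Y} → SSPath G (X ++ a ∷ b ∷ Y) →
                  (Linked (Arc G) (X ∷ʳ a) × StartsInSource G (X ∷ʳ a)) ×
                  (Linked (Arc G) (b ∷ Y) × EndsInSink G (b ∷ Y))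
  ssPath-halves X {a} {b} {Y} ssP@((rs , _) , _) with starts , ends ← ssPath-ends ssP
    with _ ∷ rs-after ← linked-++⁻ʳ X rs =
    (linked-++⁻ˡ (X ∷ʳ a) (subst (Linked (Arc G)) (sym (∷ʳ-++ X a (b ∷ Y))) rs) ,
     startsInSource-++⁻ˡ G X starts) ,
    (rs-after , endsInSink-++⁻ʳ G X ends)

  cut⇒private : ∀ X {a b} Y → SSPath G (X ++ a ∷ b ∷ Y) →
                All (λ x → indeg G x ≤ 1) (X ∷ʳ a) → All (λ x → outdeg G x ≤ 1) (b ∷ Y) → Private G a b
  cut⇒private X {a} {b} Y ssP X-indeg Y-outdeg = e , _ , ssP , (X , Y , refl) , unique
    where
    e : Arc G a b
    e with e ∷ _ ← linked-++⁻ʳ X (proj₁ (proj₁ ssP)) = e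
    unique : ∀ Q → SSPath G Q → ContainsArc G Q a b → Q ≡ X ++ a ∷ b ∷ Y
    unique Q ssQ (X′ , Y′ , refl)
      with (rsP⁻ , startsP) , (rsP⁺ , endsP) ← ssPath-halves X ssP
         | (rsQ⁻ , startsQ) , (rsQ⁺ , endsQ) ← ssPath-halves X′ ssQ =
      sym (cong₂ (λ X Y → X ++ a ∷ b ∷ Y)
        (source-path-determined G X X′ rsP⁻ rsQ⁻ startsP startsQ X-indeg)
        (sink-path-determined G b Y Y′ rsP⁺ rsQ⁺ endsP endsQ Y-outdeg))

  cond2⇒funnel : Cond2 G → Funnel G
  cond2⇒funnel c2 P ssP with x , y , zs , refl ← ssPath-shape ssP | x-src , ends ← ssPath-ends ssP =
    a , b , (before , after , cut) ,
    cut⇒private before after (subst (SSPath G) cut ssP) before-indeg after-outdeg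
    where open DegreeCut (degreeCut c2 x y zs (proj₁ (proj₁ ssP)) ends (≤-trans (≤-reflexive x-src) z≤n))

module Funnels {n : ℕ} (G : Digraph n) (acyclic : Acyclic G) where
  open Walks G
  open DAG G acyclic
  open SourceSinkPaths G
  open ≡-Reasoning

  ssPath-vertices : ∀ {s x y t} → IsSource G s → IsSink G t →
                    (σ : s ⇝ x) (e : Arc G x y) (τ : y ⇝ t) → SSPath G (vertices σ ++ vertices τ)
  ssPath-vertices {s} {t = t} s-src t-sink σ e τ with zs , eq ← vertices-∷ʳ τ =
    (rs , linked⇒unique rs) , s , t , tail-vertices σ ++ zs , cong (s ∷_) shape , s-src , t-sink
    where
    rs = subst (Linked (Arc G)) (vertices-◅◅ σ e τ) (vertices-linked (σ ◅◅ e ◅ τ))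
    shape : tail-vertices σ ++ vertices τ ≡ (tail-vertices σ ++ zs) ∷ʳ t
    shape = trans (cong (tail-vertices σ ++_) eq) (sym (++-assoc (tail-vertices σ) zs [ t ]))

  funnel⇒¬mergeSplit : Funnel G → ¬ MergeSplit G
  funnel⇒¬mergeSplit funnel (mergeSplit 1<in ρ 1<out)
    with i₁ , i₂ , i₁≢i₂ , e₁ , e₂ ← 1<indeg⇒in₂ G 1<in
       | o₁ , o₂ , o₁≢o₂ , f₁ , f₂ ← 1<outdeg⇒out₂ G 1<out
    with s₁ , s₁-src , σ₁ ← source-above i₁ | s₂ , s₂-src , σ₂ ← source-above i₂
       | t₁ , t₁-sink , τ₁ ← sink-below G acyclic o₁ | t₂ , t₂-sink , τ₂ ← sink-below G acyclic o₂
    with a , b , c₁₁ , private-ab ← funnel _ (ssPath-vertices s₁-src t₁-sink σ₁ e₁ (ρ ◅◅ f₁ ◅ τ₁))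
    with contains-split (vertices σ₁) c₁₁
  ... | inj₁ c = o₁≢o₂ (∷-injectiveˡ (++-cancelˡ (vertices ρ) _ _ (begin
          vertices ρ ++ vertices τ₁  ≡⟨ vertices-◅◅ ρ f₁ τ₁ ⟨
          vertices (ρ ◅◅ f₁ ◅ τ₁)  ≡⟨ ++-cancelˡ (vertices σ₁) _ _ P₁₁≡P₁₂ ⟩
          vertices (ρ ◅◅ f₂ ◅ τ₂)  ≡⟨ vertices-◅◅ ρ f₂ τ₂ ⟩
          vertices ρ ++ vertices τ₂  ∎)))
    where
    P₁₁≡P₁₂ = private-path-unique private-ab
      (ssPath-vertices s₁-src t₁-sink σ₁ e₁ (ρ ◅◅ f₁ ◅ τ₁)) c₁₁
      (ssPath-vertices s₁-src t₂-sink σ₁ e₁ (ρ ◅◅ f₂ ◅ τ₂))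
      (subst (λ P → ContainsArc G P a b) (∷ʳ-++ (vertices σ₁) _ _) (contains-++ʳ c _))
  ... | inj₂ c = i₁≢i₂ (vertices-last σ₁ σ₂ (++-cancelʳ _ _ _ P₁₁≡P₂₁))
    where
    P₁₁≡P₂₁ = private-path-unique private-ab
      (ssPath-vertices s₁-src t₁-sink σ₁ e₁ (ρ ◅◅ f₁ ◅ τ₁)) c₁₁
      (ssPath-vertices s₂-src t₁-sink σ₂ e₂ (ρ ◅◅ f₁ ◅ τ₁)) (contains-++ˡ (vertices σ₂) c)

-- The chain v₀ → ⋯ → v_k of D_k, built on indices so that it can be shifted along fsuc.
data ChainStep (k : ℕ) : Fin (suc k) → Fin (suc k) → Set where
  step : (i : Fin k) → ChainStep k (inject₁ i) (fsuc i)

chain-steps : ∀ k → Star (ChainStep k) fzero (fromℕ k)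
chain-steps zero    = ε
chain-steps (suc k) = step fzero ◅ Star.gmap fsuc (λ { (step i) → step (fsuc i) }) (chain-steps k)

v-chain : ∀ k → Star (ArcK k) (v fzero) (v (fromℕ k))
v-chain k = Star.gmap v (λ { (step i) → a-v i }) (chain-steps k)

module Minors {n : ℕ} (G : Digraph n) (acyclic : Acyclic G) where
  open Walks G
  open DAG G acyclic

  subgraph⇒topMinor : ∀ {k} → HasSubgraphDk G k → TopMinorDk G k
  subgraph⇒topMinor (f , f-inj , arc) = record
    { f = f ; f-inj = f-inj ; inner = λ _ → []
    ; isPath = λ e → arc-isPath (arc e)
    ; avoid = λ _ _ () ; disjoint = λ _ _ _ _ () }

  module _ {k} (tm : TopMinorDk G k) where
    open TopMinorDk tm

    branch : ∀ {x y} (e : ArcK k x y) → Linked (Arc G) (f x ∷ inner e ∷ʳ f y)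
    branch e = proj₁ (isPath e)

    branch-vertices-apart : ∀ {x y x′ y′} (e : ArcK k x y) (e′ : ArcK k x′ y′) → (x , y) ≢ (x′ , y′) →
                            ∀ {z z′} → z ≢ z′ → ∀ {c d} → c ∈ f z ∷ inner e → d ∈ f z′ ∷ inner e′ → c ≢ d
    branch-vertices-apart e e′ e≢e′ z≢z′            (here refl) (here refl) eq   = z≢z′ (f-inj eq)
    branch-vertices-apart e e′ e≢e′ {z} _           (here refl) (there d∈)  eq   = avoid e′ _ d∈ z eq
    branch-vertices-apart e e′ e≢e′ {z′ = z′} _     (there c∈)  (here refl) eq   = avoid e _ c∈ z′ (sym eq)
    branch-vertices-apart e e′ e≢e′ _               (there c∈)  (there d∈)  refl = disjoint e e′ e≢e′ _ c∈ d∈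

    image-path : ∀ {x y} → Star (ArcK k) x y → Star (Arc G) (f x) (f y)
    image-path = Star.kleisliStar f (λ e → linked⇒star (inner e) (branch e))

    topMinor⇒mergeSplit : MergeSplit G
    topMinor⇒mergeSplit
      with c₁ , c₁∈ , g₁ ← linked⇒last-step _ (inner a-u₁) (branch a-u₁)
         | c₂ , c₂∈ , g₂ ← linked⇒last-step _ (inner a-u₂) (branch a-u₂)
         | d₁ , d₁∈ , h₁ ← linked⇒first-step _ (inner a-w₁) (branch a-w₁)
         | d₂ , d₂∈ , h₂ ← linked⇒first-step _ (inner a-w₂) (branch a-w₂) =
      mergeSplit
        (in₂⇒1<indeg G (branch-vertices-apart a-u₁ a-u₂ (λ ()) (λ ()) c₁∈ c₂∈) g₁ g₂)
        (image-path (v-chain k))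
        (out₂⇒1<outdeg G (branch-vertices-apart a-w₁ a-w₂ (λ ()) (λ ()) d₁∈ d₂∈) h₁ h₂)

  mergeSplit⇒subgraph : MergeSplit G → ∃ λ k → HasSubgraphDk G k
  mergeSplit⇒subgraph (mergeSplit {q} {u} 1<in ρ 1<out)
    with i₁ , i₂ , i₁≢i₂ , e₁ , e₂ ← 1<indeg⇒in₂ G 1<in
       | o₁ , o₂ , o₁≢o₂ , f₁ , f₂ ← 1<outdeg⇒out₂ G 1<out =
    P.len , embed , embed-injective , embed-arc
    where
    module P = IndexedPath (toIndexedPath ρ)
    embed : Vk P.len → Fin n
    embed u₁    = i₁
    embed u₂    = i₂
    embed w₁    = o₁
    embed w₂    = o₂
    embed (v j) = P.vertex j
    embed-arc : ∀ {x y} → ArcK P.len x y → Arc G (embed x) (embed y)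
    embed-arc a-u₁    = subst (Arc G i₁) (sym P.vertex-first) e₁
    embed-arc a-u₂    = subst (Arc G i₂) (sym P.vertex-first) e₂
    embed-arc a-w₁    = subst (λ z → Arc G z o₁) (sym P.vertex-last) f₁
    embed-arc a-w₂    = subst (λ z → Arc G z o₂) (sym P.vertex-last) f₂
    embed-arc (a-v j) = P.step j
    in≢path : ∀ {i} → Arc G i q → ∀ j → i ≢ P.vertex j
    in≢path e j = ⇝⁺⇒≢ (⇝-◅⁺ e (P.from-start j))
    path≢out : ∀ {o} → Arc G u o → ∀ j → P.vertex j ≢ o
    path≢out f j = ⇝⁺⇒≢ (⇝-◅◅⁺ (P.to-end j) [ f ]⁺)
    in≢out : ∀ {i o} → Arc G i q → Arc G u o → i ≢ o
    in≢out e f = ⇝⁺⇒≢ (⇝-◅⁺ e (ρ ◅◅ f ◅ ε))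
    embed-injective : Injective _≡_ _≡_ embed
    embed-injective {u₁}  {u₁}  _  = refl
    embed-injective {u₂}  {u₂}  _  = refl
    embed-injective {w₁}  {w₁}  _  = refl
    embed-injective {w₂}  {w₂}  _  = refl
    embed-injective {v j} {v j′} eq = cong v (P.vertex-injective eq)
    embed-injective {u₁}  {u₂}  eq = contradiction eq i₁≢i₂
    embed-injective {u₂}  {u₁}  eq = contradiction (sym eq) i₁≢i₂
    embed-injective {w₁}  {w₂}  eq = contradiction eq o₁≢o₂
    embed-injective {w₂}  {w₁}  eq = contradiction (sym eq) o₁≢o₂
    embed-injective {u₁}  {v j} eq = contradiction eq (in≢path e₁ j)
    embed-injective {u₂}  {v j} eq = contradiction eq (in≢path e₂ j)
    embed-injective {v j} {u₁}  eq = contradiction (sym eq) (in≢path e₁ j)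
    embed-injective {v j} {u₂}  eq = contradiction (sym eq) (in≢path e₂ j)
    embed-injective {v j} {w₁}  eq = contradiction eq (path≢out f₁ j)
    embed-injective {v j} {w₂}  eq = contradiction eq (path≢out f₂ j)
    embed-injective {w₁}  {v j} eq = contradiction (sym eq) (path≢out f₁ j)
    embed-injective {w₂}  {v j} eq = contradiction (sym eq) (path≢out f₂ j)
    embed-injective {u₁}  {w₁}  eq = contradiction eq (in≢out e₁ f₁)
    embed-injective {u₁}  {w₂}  eq = contradiction eq (in≢out e₁ f₂)
    embed-injective {u₂}  {w₁}  eq = contradiction eq (in≢out e₂ f₁)
    embed-injective {u₂}  {w₂}  eq = contradiction eq (in≢out e₂ f₂)
    embed-injective {w₁}  {u₁}  eq = contradiction (sym eq) (in≢out e₁ f₁)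
    embed-injective {w₂}  {u₁}  eq = contradiction (sym eq) (in≢out e₁ f₂)
    embed-injective {w₁}  {u₂}  eq = contradiction (sym eq) (in≢out e₂ f₁)
    embed-injective {w₂}  {u₂}  eq = contradiction (sym eq) (in≢out e₂ f₂)

  subgraph⇒topMinor₁ : ∀ {k} → HasSubgraphDk G (suc k) → TopMinorDk G 1
  subgraph⇒topMinor₁ {k} (f , f-inj , arc) = record
    { f = f ∘ keep ; f-inj = keep-injective ; inner = inner ; isPath = isPath ; avoid = avoid
    ; disjoint = λ e e′ e≢e′ _ z∈ z∈′ → e≢e′ (trans (inner-on-chain e z∈) (sym (inner-on-chain e′ z∈′))) }
    where
    keep : Vk 1 → Vk (suc k)
    keep u₁             = u₁
    keep u₂             = u₂
    keep w₁             = w₁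
    keep w₂             = w₂
    keep (v fzero)      = v fzero
    keep (v (fsuc _))   = v (fromℕ (suc k))
    contract : Vk (suc k) → Vk 1
    contract u₁         = u₁
    contract u₂         = u₂
    contract w₁         = w₁
    contract w₂         = w₂
    contract (v fzero)  = v fzero
    contract (v (fsuc _)) = v (fsuc fzero)
    contract-keep : ∀ x → contract (keep x) ≡ x
    contract-keep u₁              = refl
    contract-keep u₂              = refl
    contract-keep w₁              = refl
    contract-keep w₂              = refl
    contract-keep (v fzero)       = refl
    contract-keep (v (fsuc fzero)) = refl
    keep-injective : Injective _≡_ _≡_ (f ∘ keep)
    keep-injective {x} {y} eq =
      trans (sym (contract-keep x)) (trans (cong contract (f-inj eq)) (contract-keep y))

    chain : f (v fzero) ⇝ f (v (fromℕ (suc k)))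
    chain = Star.gmap f arc (v-chain (suc k))
    chain-interior = vertices-interior (λ eq → case f-inj eq of λ ()) chain
    interior = proj₁ chain-interior
    interior-linked : Linked (Arc G) (f (v fzero) ∷ interior ∷ʳ f (v (fromℕ (suc k))))
    interior-linked = subst (Linked (Arc G)) (proj₂ chain-interior) (vertices-linked chain)

    inner : ∀ {x y} → ArcK 1 x y → List (Fin n)
    inner (a-v fzero) = interior
    inner _           = []
    inner-on-chain : ∀ {x y} (e : ArcK 1 x y) {z} → z ∈ inner e → (x , y) ≡ (v fzero , v (fsuc fzero))
    inner-on-chain (a-v fzero) _ = refl
    inner-on-chain a-u₁ ()
    inner-on-chain a-u₂ ()
    inner-on-chain a-w₁ ()
    inner-on-chain a-w₂ ()
    isPath : ∀ {x y} (e : ArcK 1 x y) → IsPath G (f (keep x) ∷ inner e ∷ʳ f (keep y))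
    isPath a-u₁        = arc-isPath (arc a-u₁)
    isPath a-u₂        = arc-isPath (arc a-u₂)
    isPath a-w₁        = arc-isPath (arc a-w₁)
    isPath a-w₂        = arc-isPath (arc a-w₂)
    isPath (a-v fzero) = interior-linked , linked⇒unique interior-linked
    avoid : ∀ {x y} (e : ArcK 1 x y) z → z ∈ inner e → ∀ w → f (keep w) ≢ z
    avoid (a-v fzero) z z∈ w with start⇝⁺z , z⇝⁺end ← linked⇒interior-between interior-linked z∈
      with w
    ... | u₁             = ⇝⁺⇒≢ (arc a-u₁ ∷⁺ start⇝⁺z)
    ... | u₂             = ⇝⁺⇒≢ (arc a-u₂ ∷⁺ start⇝⁺z)
    ... | w₁             = ⇝⁺⇒≢ (z⇝⁺end TC.∷ʳ arc a-w₁) ∘ sym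
    ... | w₂             = ⇝⁺⇒≢ (z⇝⁺end TC.∷ʳ arc a-w₂) ∘ sym
    ... | v fzero        = ⇝⁺⇒≢ start⇝⁺z
    ... | v (fsuc fzero) = ⇝⁺⇒≢ z⇝⁺end ∘ sym

theorem1 : ∀ (n : ℕ) (G : Digraph n) → Acyclic G →
    (Funnel G ⇔ Cond2 G) × (Cond2 G ⇔ Cond3 G) × (Cond3 G ⇔ Cond4 G)
theorem1 n G acyclic =
  mk⇔ funnel⇒cond2 cond2⇒funnel , mk⇔ cond2⇒cond3 cond3⇒cond2 , mk⇔ cond3⇒cond4 cond4⇒cond3
  where
  open SourceSinkPaths G
  open Funnels G acyclic
  open Minors G acyclic

  funnel⇒cond2 : Funnel G → Cond2 G
  funnel⇒cond2 = ¬mergeSplit⇒cond2 ∘ funnel⇒¬mergeSplit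

  cond2⇒cond3 : Cond2 G → Cond3 G
  cond2⇒cond3 c2 k = cond2⇒¬mergeSplit c2 ∘ topMinor⇒mergeSplit ∘ subgraph⇒topMinor

  cond3⇒cond2 : Cond3 G → Cond2 G
  cond3⇒cond2 c3 = ¬mergeSplit⇒cond2 λ ms → let k , D-k = mergeSplit⇒subgraph ms in c3 k D-k

  cond3⇒cond4 : Cond3 G → Cond4 G
  cond3⇒cond4 c3 = no-minor , no-minor
    where
    no-minor : ∀ {k} → ¬ TopMinorDk G k
    no-minor = cond2⇒¬mergeSplit (cond3⇒cond2 c3) ∘ topMinor⇒mergeSplit

  cond4⇒cond3 : Cond4 G → Cond3 G
  cond4⇒cond3 (no-D₀ , no-D₁) zero    = no-D₀ ∘ subgraph⇒topMinor
  cond4⇒cond3 (no-D₀ , no-D₁) (suc k) = no-D₁ ∘ subgraph⇒topMinor₁
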